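{- Let $k\geq 3$ be an integer and let $\mathcal{J}$ be a family of proper subsets of $[k]$ that is closed under intersection and has rank at least $k-1$. Then at least one of the following holds: (1) there exists $B\subseteq[k]$ with $|B|=k-2$ such that every subset of $B$ belongs to $\mathcal{J}$; (2) there exists a unique $i\in[k]$ such that every $D\subsetneq[k]$ with $i\in D$ belongs to $\mathcal{J}$, and every $D\subseteq[k]\setminus\{i\}$ with $|D|\geq k-2$ does not belong to $\mathcal{J}$.
   Context: For a family $\mathcal{J}$ of proper subsets of $[k]$, its rank is $r(\mathcal{J})=\min\{|D|: D\subseteq[k],\ D\not\subseteq J \text{ for every } J\in\mathcal{J}\}$. $\mathcal{J}$ is closed under intersection if $J\cap J'\in\mathcal{J}$ for all $J,J'\in\mathcal{J}$. -}

module Defs where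

open import Data.Nat using (ℕ; _≤_)
open import Data.Fin.Subset using (Subset; _⊆_; _⊂_; _∩_; ∣_∣; ⊤)
open import Data.Product using (Σ; _×_)
open import Relation.Nullary using (¬_)
open import Relation.Binary.PropositionalEquality using (_≡_; _≢_)

Family : ℕ → Set₁
Family k = Subset k → Set

ProperFamily : {k : ℕ} → Family k → Set
ProperFamily {k} 𝒥 = (J : Subset k) → 𝒥 J → J ≢ ⊤

IntersectionClosed : {k : ℕ} → Family k → Set
IntersectionClosed {k} 𝒥 = (J J′ : Subset k) → 𝒥 J → 𝒥 J′ → 𝒥 (J ∩ J′)

Covered : {k : ℕ} → Family k → Subset k → Set
Covered {k} 𝒥 D = Σ (Subset k) (λ J → 𝒥 J × D ⊆ J)

-- r(𝒥) = min { |D| : D ⊆ [k], D ⊈ J for every J ∈ 𝒥 };  IsRank 𝒥 r says r is this minimum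
IsRank : {k : ℕ} → Family k → ℕ → Set
IsRank {k} 𝒥 r =
  Σ (Subset k) (λ D → ∣ D ∣ ≡ r × ¬ Covered 𝒥 D)
  × ((D : Subset k) → ¬ Covered 𝒥 D → r ≤ ∣ D ∣)

-- Rank at least k − 1 forces every co-pair [k] ∖ {a, b} into a proper member of 𝒥, and the only
-- proper supersets of a co-pair are the co-pair itself and the coatoms [k] ∖ {a}, [k] ∖ {b}.
-- Since 𝒥 is closed under intersection, it contains every covered set D that is separated from
-- each point outside D by a member of 𝒥 containing D. If all coatoms lie in 𝒥, so does every
-- proper subset. If the coatom [k] ∖ {a} is missing but some co-pair [k] ∖ {a, c} is present, the
-- subsets of that co-pair are separated by coatoms [k] ∖ {x} or co-pairs [k] ∖ {a, x}. If no such
-- co-pair is present, every other coatom is, and a is the point of the second alternative.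
module Submission where

open import Defs
open import Data.Nat using (ℕ; suc; _≤_; _<_; _∸_; s≤s)
open import Data.Nat.Properties using (suc-injective; n≤1+n; <⇒≱)
open import Data.Fin using (Fin; _≟_) renaming (zero to 0F; suc to 1+_)
open import Data.Fin.Properties using (any?; all?; ¬∀⟶∃¬)
open import Data.Fin.Subset using (Subset; _⊆_; _⊂_; _∈_; _∉_; ∣_∣; ⊤; _∩_; _─_; _-_; ⁅_⁆; inside; outside)
open import Data.Fin.Subset.Properties
  using (_∈?_; ∈⊤; ⊆⊤; ⊆-antisym; p∩q⊆p; p∩q⊆q; x∈p∩q⁺; p─q⊆p; p─⊥≡p; p─x─y≡p─y─x;
         x∈p∧x≢y⇒x∈p-y; x∈p⇒p-x⊂p; x∉⁅y⁆⇒x≢y; ∣⊤∣≡n; p⊂q⇒∣p∣<∣q∣)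
open import Data.Vec using (_∷_; here; there)
open import Data.List using (List; []; _∷_; allFin)
open import Data.List.Relation.Unary.All as All using (All; []; _∷_)
open import Data.List.Membership.Propositional.Properties using (∈-allFin)
open import Data.Product using (Σ; Σ-syntax; _×_; _,_)
open import Data.Sum using (_⊎_; inj₁; inj₂; [_,_]′)
open import Function using (_∘_; id)
open import Relation.Nullary using (¬_; yes; no; contradiction; ¬?)
open import Relation.Nullary.Decidable using (_×-dec_; decidable-stable)
open import Relation.Unary using (Decidable)
open import Relation.Binary.PropositionalEquality using (_≡_; _≢_; refl; sym; cong; subst)

private
  variable
    k n : ℕ

x∈p─q⇒x∉q : ∀ {x : Fin k} (p q : Subset k) → x ∈ p ─ q → x ∉ q
x∈p─q⇒x∉q (_ ∷ p) (outside ∷ q) here      ()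
x∈p─q⇒x∉q (_ ∷ p) (_       ∷ q) (there x∈) (there x∈q) = x∈p─q⇒x∉q p q x∈ x∈q

x∈p-y⇒x≢y : ∀ {x y : Fin k} (p : Subset k) → x ∈ p - y → x ≢ y
x∈p-y⇒x≢y {y = y} p = x∉⁅y⁆⇒x≢y ∘ x∈p─q⇒x∉q p ⁅ y ⁆

x∉p-x : ∀ (p : Subset k) {x} → x ∉ p - x
x∉p-x p x∈ = x∈p-y⇒x≢y p x∈ refl

p⊆q∧x∉p⇒p⊆q-x : ∀ {p q : Subset k} {x} → p ⊆ q → x ∉ p → p ⊆ q - x
p⊆q∧x∉p⇒p⊆q-x p⊆q x∉p y∈p = x∈p∧x≢y⇒x∈p-y (p⊆q y∈p) λ { refl → x∉p y∈p }

p-x⊆q∧x∈q⇒p⊆q : ∀ {p q : Subset k} {x} → p - x ⊆ q → x ∈ q → p ⊆ q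
p-x⊆q∧x∈q⇒p⊆q {x = x} p-x⊆q x∈q {y} y∈p with y ≟ x
... | yes refl = x∈q
... | no  y≢x  = p-x⊆q (x∈p∧x≢y⇒x∈p-y y∈p y≢x)

x∈p⇒suc∣p-x∣≡∣p∣ : ∀ {p : Subset k} {x} → x ∈ p → suc ∣ p - x ∣ ≡ ∣ p ∣
x∈p⇒suc∣p-x∣≡∣p∣ {p = inside  ∷ p} here       = cong (suc ∘ ∣_∣) (p─⊥≡p p)
x∈p⇒suc∣p-x∣≡∣p∣ {p = inside  ∷ p} (there x∈p) = cong suc (x∈p⇒suc∣p-x∣≡∣p∣ x∈p)
x∈p⇒suc∣p-x∣≡∣p∣ {p = outside ∷ p} (there x∈p) = x∈p⇒suc∣p-x∣≡∣p∣ x∈p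

∣⊤-x∣≡n : (x : Fin (suc n)) → ∣ ⊤ - x ∣ ≡ n
∣⊤-x∣≡n {n} x =
  suc-injective (subst (suc ∣ ⊤ - x ∣ ≡_) (∣⊤∣≡n (suc n)) (x∈p⇒suc∣p-x∣≡∣p∣ {p = ⊤} {x} ∈⊤))

∣⊤-x-y∣≡n : {x y : Fin (suc (suc n))} → y ≢ x → ∣ ⊤ - x - y ∣ ≡ n
∣⊤-x-y∣≡n {x = x} y≢x =
  suc-injective (subst (suc ∣ ⊤ - x - _ ∣ ≡_) (∣⊤-x∣≡n x) (x∈p⇒suc∣p-x∣≡∣p∣ {p = ⊤ - x} (x∈p∧x≢y⇒x∈p-y ∈⊤ y≢x)))

large-subsets-avoiding : ∀ {D : Subset (suc (suc n))} {x} → x ∉ D → n ≤ ∣ D ∣ →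
  D ≡ ⊤ - x ⊎ Σ[ y ∈ Fin (suc (suc n)) ] y ≢ x × D ≡ ⊤ - x - y
large-subsets-avoiding {D = D} {x} x∉D n≤∣D∣ with any? (λ y → ¬? (y ≟ x) ×-dec ¬? (y ∈? D))
... | no ∄y = inj₁ (⊆-antisym (p⊆q∧x∉p⇒p⊆q-x ⊆⊤ x∉D) ⊤-x⊆D)
  where
  ⊤-x⊆D : ⊤ - x ⊆ D
  ⊤-x⊆D {y} y∈ = decidable-stable (y ∈? D) λ y∉D → ∄y (y , x∈p-y⇒x≢y ⊤ y∈ , y∉D)
... | yes (y , y≢x , y∉D) = inj₂ (y , y≢x , ⊆-antisym D⊆ ⊤-x-y⊆D)
  where
  D⊆ : D ⊆ ⊤ - x - y
  D⊆ = p⊆q∧x∉p⇒p⊆q-x (p⊆q∧x∉p⇒p⊆q-x ⊆⊤ x∉D) y∉D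
  -- a missing point would make D a proper subset of a set of size n
  ⊤-x-y⊆D : ⊤ - x - y ⊆ D
  ⊤-x-y⊆D {z} z∈ = decidable-stable (z ∈? D) λ z∉D →
    <⇒≱ (subst (∣ D ∣ <_) (∣⊤-x-y∣≡n y≢x) (p⊂q⇒∣p∣<∣q∣ (D⊆ , z , z∈ , z∉D))) n≤∣D∣

Separator : {k : ℕ} → Family k → Subset k → Fin k → Set
Separator {k} 𝒥 D x = Σ[ M ∈ Subset k ] 𝒥 M × D ⊆ M × x ∉ M

module _ {𝒥 : Family k} (closed : IntersectionClosed 𝒥) where

  ∈-from-separators : ∀ {D} → Covered 𝒥 D → (∀ x → x ∉ D → Separator 𝒥 D x) → 𝒥 D
  ∈-from-separators {D} (J₀ , J₀∈ , D⊆J₀) separator =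
    let J , J∈ , D⊆J , ∉J = excluding (allFin k)
        J⊆D : J ⊆ D
        J⊆D {x} x∈J = decidable-stable (x ∈? D) λ x∉D → All.lookup ∉J (∈-allFin x) x∉D x∈J
    in subst 𝒥 (⊆-antisym J⊆D D⊆J) J∈
    where
    excluding : (xs : List (Fin k)) → Σ[ J ∈ Subset k ] 𝒥 J × D ⊆ J × All (λ x → x ∉ D → x ∉ J) xs
    excluding [] = J₀ , J₀∈ , D⊆J₀ , []
    excluding (y ∷ ys) with excluding ys | y ∈? D
    ... | J , J∈ , D⊆J , ∉J | yes y∈D = J , J∈ , D⊆J , (contradiction y∈D) ∷ ∉J
    ... | J , J∈ , D⊆J , ∉J | no  y∉D with separator y y∉D
    ... | M , M∈ , D⊆M , y∉M =
      J ∩ M , closed J M J∈ M∈ , (λ x∈D → x∈p∩q⁺ (D⊆J x∈D , D⊆M x∈D)) ,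
      (λ _ → y∉M ∘ p∩q⊆q J M) ∷ All.map (λ x∉J x∉D → x∉J x∉D ∘ p∩q⊆p J M) ∉J

  ∈-from-coatoms : ∀ {D x} → (∀ y → y ∉ D → 𝒥 (⊤ - y)) → x ∉ D → 𝒥 D
  ∈-from-coatoms coatoms x∉D =
    ∈-from-separators (⊤ - _ , coatoms _ x∉D , p⊆q∧x∉p⇒p⊆q-x ⊆⊤ x∉D)
      λ y y∉D → ⊤ - y , coatoms y y∉D , p⊆q∧x∉p⇒p⊆q-x ⊆⊤ y∉D , x∉p-x ⊤

  subsets-of-co-pair : ∀ {a b} → 𝒥 (⊤ - a - b) →
    (∀ x → x ≢ a → x ≢ b → 𝒥 (⊤ - x) ⊎ 𝒥 (⊤ - a - x)) →
    ∀ D → D ⊆ ⊤ - a - b → 𝒥 D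
  subsets-of-co-pair {a} {b} ab∈ separating D D⊆ =
    ∈-from-separators (⊤ - a - b , ab∈ , D⊆) separator
    where
    separator : ∀ x → x ∉ D → Separator 𝒥 D x
    separator x x∉D with x ≟ a | x ≟ b
    ... | yes refl | _        = ⊤ - a - b , ab∈ , D⊆ , x∉p-x ⊤ ∘ p─q⊆p (⊤ - a) ⁅ b ⁆
    ... | no _     | yes refl = ⊤ - a - b , ab∈ , D⊆ , x∉p-x (⊤ - a)
    ... | no x≢a   | no x≢b   with separating x x≢a x≢b
    ... | inj₁ x∈  = ⊤ - x , x∈ , p⊆q∧x∉p⇒p⊆q-x ⊆⊤ x∉D , x∉p-x ⊤
    ... | inj₂ ax∈ = ⊤ - a - x , ax∈ , p⊆q∧x∉p⇒p⊆q-x (p─q⊆p (⊤ - a) ⁅ b ⁆ ∘ D⊆) x∉D ,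
                     x∉p-x (⊤ - a)

covering-co-pair : ∀ {𝒥 : Family k} → ProperFamily 𝒥 → ∀ {a b} →
  Covered 𝒥 (⊤ - a - b) → 𝒥 (⊤ - a) ⊎ 𝒥 (⊤ - b) ⊎ 𝒥 (⊤ - a - b)
covering-co-pair {𝒥 = 𝒥} proper {a} {b} (J , J∈ , ⊆J) with a ∈? J | b ∈? J
... | yes a∈J | yes b∈J =
  contradiction (⊆-antisym ⊆⊤ (p-x⊆q∧x∈q⇒p⊆q (p-x⊆q∧x∈q⇒p⊆q ⊆J b∈J) a∈J)) (proper J J∈)
... | yes a∈J | no  b∉J =
  inj₂ (inj₁ (subst 𝒥 (⊆-antisym (p⊆q∧x∉p⇒p⊆q-x ⊆⊤ b∉J) (p-x⊆q∧x∈q⇒p⊆q ⊤-b-a⊆J a∈J)) J∈))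
  where
  ⊤-b-a⊆J : ⊤ - b - a ⊆ J
  ⊤-b-a⊆J = subst (λ p → p ⊆ J) (p─x─y≡p─y─x ⊤ a b) ⊆J
... | no  a∉J | yes b∈J =
  inj₁ (subst 𝒥 (⊆-antisym (p⊆q∧x∉p⇒p⊆q-x ⊆⊤ a∉J) (p-x⊆q∧x∈q⇒p⊆q ⊆J b∈J)) J∈)
... | no  a∉J | no  b∉J =
  inj₂ (inj₂ (subst 𝒥 (⊆-antisym (p⊆q∧x∉p⇒p⊆q-x (p⊆q∧x∉p⇒p⊆q-x ⊆⊤ a∉J) b∉J) ⊆J) J∈))

below-rank⇒¬¬covered : ∀ {𝒥 : Family k} {r D} → IsRank 𝒥 r → ∣ D ∣ < r → ¬ ¬ Covered 𝒥 D
below-rank⇒¬¬covered (_ , minimal) ∣D∣<r ¬covered = <⇒≱ ∣D∣<r (minimal _ ¬covered)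

module _ {n : ℕ} (𝒥 : Family (suc (suc n))) where

  Pivot : Fin (suc (suc n)) → Set
  Pivot i = ((D : Subset (suc (suc n))) → D ⊂ ⊤ → i ∈ D → 𝒥 D)
          × ((D : Subset (suc (suc n))) → i ∉ D → n ≤ ∣ D ∣ → ¬ 𝒥 D)

  pivot-unique : ∀ {i j} → Pivot i → Pivot j → j ≡ i
  pivot-unique {i} {j} (contains-i , _) (_ , avoids-j) with j ≟ i
  ... | yes j≡i = j≡i
  ... | no  j≢i = contradiction (contains-i (⊤ - j) (x∈p⇒p-x⊂p ∈⊤) (x∈p∧x≢y⇒x∈p-y ∈⊤ (j≢i ∘ sym)))
                                (avoids-j (⊤ - j) (x∉p-x ⊤) n≤∣⊤-j∣)
    where
    n≤∣⊤-j∣ : n ≤ ∣ ⊤ - j ∣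
    n≤∣⊤-j∣ = subst (n ≤_) (sym (∣⊤-x∣≡n j)) (n≤1+n n)

  Conclusion : Set
  Conclusion = (Σ[ B ∈ Subset (suc (suc n)) ] ∣ B ∣ ≡ n × ((D : Subset (suc (suc n))) → D ⊆ B → 𝒥 D))
             ⊎ Σ[ i ∈ Fin (suc (suc n)) ] Pivot i × ((j : Fin (suc (suc n))) → Pivot j → j ≡ i)

module _ {n : ℕ} {𝒥 : Family (suc (suc n))} (dec : Decidable 𝒥)
  (proper : ProperFamily 𝒥) (closed : IntersectionClosed 𝒥)
  {r : ℕ} (rank : IsRank 𝒥 r) (r>n : n < r) where

  coatom-or-co-pair : ∀ {a x} → ¬ 𝒥 (⊤ - a) → x ≢ a → 𝒥 (⊤ - x) ⊎ 𝒥 (⊤ - a - x)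
  coatom-or-co-pair {a} {x} a∉ x≢a with dec (⊤ - x) | dec (⊤ - a - x)
  ... | yes x∈ | _        = inj₁ x∈
  ... | no  _  | yes ax∈  = inj₂ ax∈
  ... | no  x∉ | no  ax∉  =
    contradiction (λ covered → [ a∉ , [ x∉ , ax∉ ]′ ]′ (covering-co-pair proper covered))
      (below-rank⇒¬¬covered rank (subst (_< r) (sym (∣⊤-x-y∣≡n x≢a)) r>n))

  coatoms-conclusion : (∀ a → 𝒥 (⊤ - a)) → Conclusion 𝒥
  coatoms-conclusion coatom∈ = inj₁ (⊤ - 0F - 1+ 0F , ∣⊤-x-y∣≡n {x = 0F} {1+ 0F} (λ ()) , λ D D⊆ →
    ∈-from-coatoms closed (λ y _ → coatom∈ y) (x∉p-x ⊤ {0F} ∘ p─q⊆p (⊤ - 0F) ⁅ 1+ 0F ⁆ ∘ D⊆))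

  co-pair-conclusion : ∀ {a c} → ¬ 𝒥 (⊤ - a) → c ≢ a → 𝒥 (⊤ - a - c) → Conclusion 𝒥
  co-pair-conclusion a∉ c≢a ac∈ =
    inj₁ (_ , ∣⊤-x-y∣≡n c≢a , subsets-of-co-pair closed ac∈ λ x x≢a _ → coatom-or-co-pair a∉ x≢a)

  pivot-conclusion : ∀ {a} → ¬ 𝒥 (⊤ - a) → (∀ c → c ≢ a → ¬ 𝒥 (⊤ - a - c)) → Conclusion 𝒥
  pivot-conclusion {a} a∉ co-pairs∉ = inj₂ (a , pivot , λ j → pivot-unique 𝒥 pivot)
    where
    coatom∈ : ∀ b → b ≢ a → 𝒥 (⊤ - b)
    coatom∈ b b≢a = [ id , (λ ab∈ → contradiction ab∈ (co-pairs∉ b b≢a)) ]′ (coatom-or-co-pair a∉ b≢a)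

    pivot : Pivot 𝒥 a
    pivot = contains , avoids
      where
      contains : ∀ D → D ⊂ ⊤ → a ∈ D → 𝒥 D
      contains D (_ , x , _ , x∉D) a∈D =
        ∈-from-coatoms closed (λ y y∉D → coatom∈ y λ { refl → y∉D a∈D }) x∉D

      avoids : ∀ D → a ∉ D → n ≤ ∣ D ∣ → ¬ 𝒥 D
      avoids D a∉D n≤∣D∣ with large-subsets-avoiding a∉D n≤∣D∣
      ... | inj₁ refl              = a∉
      ... | inj₂ (c , c≢a , refl)  = co-pairs∉ c c≢a

  conclusion : Conclusion 𝒥
  conclusion with all? (λ a → dec (⊤ - a))
  ... | yes coatom∈ = coatoms-conclusion coatom∈
  ... | no ¬coatoms with ¬∀⟶∃¬ _ _ (λ a → dec (⊤ - a)) ¬coatoms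
  ... | a , a∉ with any? (λ c → ¬? (c ≟ a) ×-dec dec (⊤ - a - c))
  ... | yes (c , c≢a , ac∈) = co-pair-conclusion a∉ c≢a ac∈
  ... | no  ∄c              = pivot-conclusion a∉ λ c c≢a ac∈ → ∄c (c , c≢a , ac∈)

lemma3p4 : (k : ℕ) → 3 ≤ k → (𝒥 : Family k) → Decidable 𝒥 →
    ProperFamily 𝒥 → IntersectionClosed 𝒥 →
    (r : ℕ) → IsRank 𝒥 r → k ∸ 1 ≤ r →
    Σ (Subset k) (λ B → ∣ B ∣ ≡ k ∸ 2 × ((D : Subset k) → D ⊆ B → 𝒥 D))
    ⊎ Σ (Fin k) (λ i →
        (((D : Subset k) → D ⊂ ⊤ → i ∈ D → 𝒥 D)
          × ((D : Subset k) → i ∉ D → k ∸ 2 ≤ ∣ D ∣ → ¬ 𝒥 D))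
        × ((j : Fin k) →
            (((D : Subset k) → D ⊂ ⊤ → j ∈ D → 𝒥 D)
              × ((D : Subset k) → j ∉ D → k ∸ 2 ≤ ∣ D ∣ → ¬ 𝒥 D))
            → j ≡ i))
-- The argument only needs k ≥ 2.
lemma3p4 (suc (suc n)) _ 𝒥 dec proper closed r rank r≥k-1 = conclusion dec proper closed rank r≥k-1
lemma3p4 1 (s≤s ())
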